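{- Let $\Pi$ be a finite projective plane and let $\mathcal{S}$ be a semioval in $\Pi$. Suppose that $\mathcal{T}\subset \mathcal{S}$ is a pointset with the property that for every line $\ell$ of $\Pi$ which is a secant line to $\mathcal{S}$ (i.e. $|\ell\cap\mathcal{S}|\geq 2$) the inequality $|\mathcal{S}\cap \ell| \geq |\mathcal{T}\cap \ell| + 2$ holds. Then $\mathcal{S}\setminus\mathcal{T}$ is a semioval, and $\mathcal{S}$ contains semiovals of size $k$ for every integer $k$ with $|\mathcal{S}\setminus\mathcal{T}|\leq k\leq |\mathcal{S}|$.
   Context: A semioval in a projective plane is a non-empty pointset $\mathcal{S}$ such that for every point $P\in\mathcal{S}$ there is a unique line $t_P$ with $\mathcal{S}\cap t_P=\{P\}$ (the tangent line at $P$). -}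

module Defs where

open import Data.Nat using (ℕ; _≤_; _+_)
open import Data.Fin using (Fin)
open import Data.Fin.Subset using (Subset; _∈_; _∉_; _∩_; ⁅_⁆; ∣_∣; Nonempty; _⊆_; _─_)
open import Data.Product using (Σ; ∃; _×_; _,_)
open import Relation.Binary.PropositionalEquality using (_≡_; _≢_)

open import Data.Empty using (⊥)

¬3 : Set → Set → Set → Set
¬3 A B C = A → B → C → ⊥

record ProjectivePlane (np nl : ℕ) : Set where
  field
    line : Fin nl → Subset np
    joinExists : ∀ (P Q : Fin np) → P ≢ Q → ∃ λ ℓ → P ∈ line ℓ × Q ∈ line ℓ
    joinUnique : ∀ (P Q : Fin np) → P ≢ Q → ∀ ℓ m →
                 P ∈ line ℓ → Q ∈ line ℓ → P ∈ line m → Q ∈ line m → ℓ ≡ m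
    meetExists : ∀ (ℓ m : Fin nl) → ℓ ≢ m → ∃ λ P → P ∈ line ℓ × P ∈ line m
    meetUnique : ∀ (ℓ m : Fin nl) → ℓ ≢ m → ∀ P Q →
                 P ∈ line ℓ → P ∈ line m → Q ∈ line ℓ → Q ∈ line m → P ≡ Q
    p₁ p₂ p₃ p₄ : Fin np
    distinct : p₁ ≢ p₂ × p₁ ≢ p₃ × p₁ ≢ p₄ × p₂ ≢ p₃ × p₂ ≢ p₄ × p₃ ≢ p₄
    noThreeCollinear : ∀ ℓ →
      ¬3 (p₁ ∈ line ℓ) (p₂ ∈ line ℓ) (p₃ ∈ line ℓ) ×
      ¬3 (p₁ ∈ line ℓ) (p₂ ∈ line ℓ) (p₄ ∈ line ℓ) ×
      ¬3 (p₁ ∈ line ℓ) (p₃ ∈ line ℓ) (p₄ ∈ line ℓ) ×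
      ¬3 (p₂ ∈ line ℓ) (p₃ ∈ line ℓ) (p₄ ∈ line ℓ)

module _ {np nl : ℕ} (Π : ProjectivePlane np nl) where
  open ProjectivePlane Π

  IsTangent : Subset np → Fin np → Fin nl → Set
  IsTangent S P ℓ = S ∩ line ℓ ≡ ⁅ P ⁆

  Semioval : Subset np → Set
  Semioval S = Nonempty S ×
    (∀ P → P ∈ S → ∃ λ t → IsTangent S P t × (∀ t′ → IsTangent S P t′ → t′ ≡ t))

-- The tangent at P ∈ S to any S′ with S ∖ T ⊆ S′ ⊆ S is still the tangent of S at P:
-- it meets S′ only in P, and any other line through P is a secant of S, so by the
-- hypothesis it carries at least two points of S outside T, and hence meets S′ twice.
-- Non-emptiness comes from a secant of S, which exists because some line through
-- a point of S misses a point of its tangent; such a secant has a point outside T.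
-- Subsets of every size between |S ∖ T| and |S| are then obtained by deleting points.
module Submission where

open import Defs
open import Data.Nat using (ℕ; suc; zero; _≤_; _<_; _+_; _∸_; s≤s; z≤n)
open import Data.Nat.Properties hiding (_≟_)
open import Data.Fin using (Fin; _≟_)
import Data.Fin.Properties as Fin
open import Data.Fin.Subset
open import Data.Fin.Subset.Properties
open import Data.Bool using (true; false)
open import Data.Vec using (_∷_; [])
open import Data.Product using (∃; _×_; _,_; proj₁; proj₂)
open import Data.Sum using (_⊎_; inj₁; inj₂)
open import Function using (id)
open import Relation.Nullary using (yes; no; contradiction; ¬?)
open import Relation.Nullary.Decidable using (_×-dec_)
open import Relation.Binary.PropositionalEquality

∣p∪q∣≤∣p∣+∣q∣ : ∀ {n} (p q : Subset n) → ∣ p ∪ q ∣ ≤ ∣ p ∣ + ∣ q ∣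
∣p∪q∣≤∣p∣+∣q∣ [] [] = z≤n
∣p∪q∣≤∣p∣+∣q∣ (true  ∷ p) (true  ∷ q) =
  s≤s (≤-trans (∣p∪q∣≤∣p∣+∣q∣ p q) (+-monoʳ-≤ ∣ p ∣ (n≤1+n ∣ q ∣)))
∣p∪q∣≤∣p∣+∣q∣ (true  ∷ p) (false ∷ q) = s≤s (∣p∪q∣≤∣p∣+∣q∣ p q)
∣p∪q∣≤∣p∣+∣q∣ (false ∷ p) (true  ∷ q) =
  ≤-trans (s≤s (∣p∪q∣≤∣p∣+∣q∣ p q)) (≤-reflexive (sym (+-suc ∣ p ∣ ∣ q ∣)))
∣p∪q∣≤∣p∣+∣q∣ (false ∷ p) (false ∷ q) = ∣p∪q∣≤∣p∣+∣q∣ p q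

module _ {n : ℕ} where

  p⊆q∪r⇒∣p∣≤∣q∣+∣r∣ : {p : Subset n} (q r : Subset n) → p ⊆ q ∪ r → ∣ p ∣ ≤ ∣ q ∣ + ∣ r ∣
  p⊆q∪r⇒∣p∣≤∣q∣+∣r∣ q r p⊆q∪r = ≤-trans (p⊆q⇒∣p∣≤∣q∣ p⊆q∪r) (∣p∪q∣≤∣p∣+∣q∣ q r)

  p─r⊆q⇒∣p∩s∣≤∣q∩s∣+∣r∩s∣ : {p q r : Subset n} (s : Subset n) → p ─ r ⊆ q →
                             ∣ p ∩ s ∣ ≤ ∣ q ∩ s ∣ + ∣ r ∩ s ∣
  p─r⊆q⇒∣p∩s∣≤∣q∩s∣+∣r∩s∣ {p} {q} {r} s p─r⊆q = p⊆q∪r⇒∣p∣≤∣q∣+∣r∣ (q ∩ s) (r ∩ s) cover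
    where
    cover : p ∩ s ⊆ (q ∩ s) ∪ (r ∩ s)
    cover {x} x∈p∩s with x∈p∩q⁻ p s x∈p∩s | x ∈? r
    ... | _   , x∈s | yes x∈r = x∈p∪q⁺ (inj₂ (x∈p∩q⁺ (x∈r , x∈s)))
    ... | x∈p , x∈s | no  x∉r = x∈p∪q⁺ (inj₁ (x∈p∩q⁺ (p─r⊆q (x∈p∧x∉q⇒x∈p─q x∈p x∉r) , x∈s)))

  x∈p⇒⁅x⁆⊆p : {x : Fin n} {p : Subset n} → x ∈ p → ⁅ x ⁆ ⊆ p
  x∈p⇒⁅x⁆⊆p {x} x∈p y∈⁅x⁆ = subst (_∈ _) (sym (x∈⁅y⁆⇒x≡y x y∈⁅x⁆)) x∈p

  x∈p∧∣p∣≤1⇒p≡⁅x⁆ : {x : Fin n} {p : Subset n} → x ∈ p → ∣ p ∣ ≤ 1 → p ≡ ⁅ x ⁆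
  x∈p∧∣p∣≤1⇒p≡⁅x⁆ {x} {p} x∈p ∣p∣≤1 = ⊆-antisym p⊆⁅x⁆ (x∈p⇒⁅x⁆⊆p x∈p)
    where
    p⊆⁅x⁆ : p ⊆ ⁅ x ⁆
    p⊆⁅x⁆ {y} y∈p with y ≟ x
    ... | yes refl = x∈⁅x⁆ x
    ... | no  y≢x  = contradiction ∣p∣≤1 (<⇒≱ (subst (_< ∣ p ∣) (∣⁅x⁆∣≡1 x) ∣⁅x⁆∣<∣p∣))
      where
      ∣⁅x⁆∣<∣p∣ : ∣ ⁅ x ⁆ ∣ < ∣ p ∣
      ∣⁅x⁆∣<∣p∣ = p⊂q⇒∣p∣<∣q∣ (x∈p⇒⁅x⁆⊆p x∈p , y , y∈p , x≢y⇒x∉⁅y⁆ y≢x)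

  ∣p∣<∣q∣⇒∃x∈q∧x∉p : (p q : Subset n) → ∣ p ∣ < ∣ q ∣ → ∃ λ x → x ∈ q × x ∉ p
  ∣p∣<∣q∣⇒∃x∈q∧x∉p p q ∣p∣<∣q∣ with Fin.any? (λ x → x ∈? q ×-dec ¬? (x ∈? p))
  ... | yes witness = witness
  ... | no  none    = contradiction (p⊆q⇒∣p∣≤∣q∣ q⊆p) (<⇒≱ ∣p∣<∣q∣)
    where
    q⊆p : q ⊆ p
    q⊆p {x} x∈q with x ∈? p
    ... | yes x∈p = x∈p
    ... | no  x∉p = contradiction (x , x∈q , x∉p) none

  x∈p⇒suc∣p-x∣≡∣p∣ : {x : Fin n} {p : Subset n} → x ∈ p → suc ∣ p - x ∣ ≡ ∣ p ∣
  x∈p⇒suc∣p-x∣≡∣p∣ {x} {p} x∈p = ≤-antisym (x∈p⇒∣p-x∣<∣p∣ x∈p) ∣p∣≤suc∣p-x∣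
    where
    cover : p ⊆ (p - x) ∪ ⁅ x ⁆
    cover {y} y∈p with y ≟ x
    ... | yes refl = x∈p∪q⁺ (inj₂ (x∈⁅x⁆ x))
    ... | no  y≢x  = x∈p∪q⁺ (inj₁ (x∈p∧x≢y⇒x∈p-y y∈p y≢x))
    ∣p∣≤suc∣p-x∣ : ∣ p ∣ ≤ suc ∣ p - x ∣
    ∣p∣≤suc∣p-x∣ = begin
      ∣ p ∣                   ≤⟨ p⊆q∪r⇒∣p∣≤∣q∣+∣r∣ (p - x) ⁅ x ⁆ cover ⟩
      ∣ p - x ∣ + ∣ ⁅ x ⁆ ∣   ≡⟨ cong (∣ p - x ∣ +_) (∣⁅x⁆∣≡1 x) ⟩
      ∣ p - x ∣ + 1           ≡⟨ +-comm ∣ p - x ∣ 1 ⟩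
      suc ∣ p - x ∣           ∎
      where open ≤-Reasoning

  ∃-between-of-size′ : ∀ m {k} {a b : Subset n} → a ⊆ b → ∣ a ∣ ≤ k → ∣ b ∣ ≡ m + k →
                       ∃ λ c → a ⊆ c × c ⊆ b × ∣ c ∣ ≡ k
  ∃-between-of-size′ zero    {b = b} a⊆b _ ∣b∣≡k = b , a⊆b , id , ∣b∣≡k
  ∃-between-of-size′ (suc m) {k} {a} {b} a⊆b ∣a∣≤k ∣b∣≡1+m+k with ∣p∣<∣q∣⇒∃x∈q∧x∉p a b ∣a∣<∣b∣
    where
    ∣a∣<∣b∣ : ∣ a ∣ < ∣ b ∣
    ∣a∣<∣b∣ = ≤-<-trans ∣a∣≤k (subst (k <_) (sym ∣b∣≡1+m+k) (s≤s (m≤n+m k m)))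
  ... | x , x∈b , x∉a with ∃-between-of-size′ m a⊆b-x ∣a∣≤k ∣b-x∣≡m+k
    where
    a⊆b-x : a ⊆ b - x
    a⊆b-x y∈a = x∈p∧x≢y⇒x∈p-y (a⊆b y∈a) (λ { refl → x∉a y∈a })
    ∣b-x∣≡m+k : ∣ b - x ∣ ≡ m + k
    ∣b-x∣≡m+k = suc-injective (trans (x∈p⇒suc∣p-x∣≡∣p∣ x∈b) ∣b∣≡1+m+k)
  ... | c , a⊆c , c⊆b-x , ∣c∣≡k = c , a⊆c , (λ y∈c → p─q⊆p b ⁅ x ⁆ (c⊆b-x y∈c)) , ∣c∣≡k

  ∃-between-of-size : ∀ {k} {a b : Subset n} → a ⊆ b → ∣ a ∣ ≤ k → k ≤ ∣ b ∣ →
                      ∃ λ c → a ⊆ c × c ⊆ b × ∣ c ∣ ≡ k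
  ∃-between-of-size {k} {b = b} a⊆b ∣a∣≤k k≤∣b∣ =
    ∃-between-of-size′ (∣ b ∣ ∸ k) a⊆b ∣a∣≤k (sym (m∸n+n≡m k≤∣b∣))

module _ {np nl : ℕ} (Π : ProjectivePlane np nl) where
  open ProjectivePlane Π

  Secant : Subset np → Fin nl → Set
  Secant S ℓ = 2 ≤ ∣ S ∩ line ℓ ∣

  ∃-point-off-line : ∀ ℓ → ∃ λ Q → Q ∉ line ℓ
  ∃-point-off-line ℓ with p₁ ∈? line ℓ | p₂ ∈? line ℓ | p₃ ∈? line ℓ
  ... | no  p₁∉ℓ | _        | _        = p₁ , p₁∉ℓ
  ... | yes _    | no  p₂∉ℓ | _        = p₂ , p₂∉ℓ
  ... | yes _    | yes _    | no  p₃∉ℓ = p₃ , p₃∉ℓ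
  ... | yes p₁∈ℓ | yes p₂∈ℓ | yes p₃∈ℓ =
    contradiction p₃∈ℓ (proj₁ (noThreeCollinear ℓ) p₁∈ℓ p₂∈ℓ)

  module _ {S : Subset np} {P : Fin np} where

    tangent-point∈line : ∀ {t} → IsTangent Π S P t → P ∈ line t
    tangent-point∈line tangent = proj₂ (x∈p∩q⁻ S _ (subst (P ∈_) (sym tangent) (x∈⁅x⁆ P)))

    tangent⊎secant : ∀ {ℓ} → P ∈ S → P ∈ line ℓ → IsTangent Π S P ℓ ⊎ Secant S ℓ
    tangent⊎secant {ℓ} P∈S P∈ℓ with 2 ≤? ∣ S ∩ line ℓ ∣
    ... | yes secant = inj₂ secant
    ... | no  ¬secant = inj₁ (x∈p∧∣p∣≤1⇒p≡⁅x⁆ (x∈p∩q⁺ (P∈S , P∈ℓ)) (≤-pred (≰⇒> ¬secant)))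

    tangent-⊆ : ∀ {S′ t} → S′ ⊆ S → P ∈ S′ → IsTangent Π S P t → IsTangent Π S′ P t
    tangent-⊆ {S′} S′⊆S P∈S′ tangent =
      ⊆-antisym S′∩t⊆⁅P⁆ (x∈p⇒⁅x⁆⊆p (x∈p∩q⁺ (P∈S′ , tangent-point∈line tangent)))
      where
      S′∩t⊆⁅P⁆ : S′ ∩ line _ ⊆ ⁅ P ⁆
      S′∩t⊆⁅P⁆ {y} y∈S′∩t with x∈p∩q⁻ S′ _ y∈S′∩t
      ... | y∈S′ , y∈t = subst (y ∈_) tangent (x∈p∩q⁺ (S′⊆S y∈S′ , y∈t))

  semioval⇒∃secant : ∀ {S} → Semioval Π S → ∃ (Secant S)
  semioval⇒∃secant ((P , P∈S) , tangents) with tangents P P∈S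
  ... | t , tangent , unique with ∃-point-off-line t
  ... | Q , Q∉t with joinExists P Q (λ { refl → Q∉t (tangent-point∈line tangent) })
  ... | ℓ , P∈ℓ , Q∈ℓ with tangent⊎secant P∈S P∈ℓ
  ... | inj₁ tangent′ = contradiction (subst (λ m → Q ∈ line m) (unique ℓ tangent′) Q∈ℓ) Q∉t
  ... | inj₂ secant   = ℓ , secant

  semioval-between : ∀ {S T S′} → Semioval Π S →
                     (∀ ℓ → Secant S ℓ → ∣ T ∩ line ℓ ∣ + 2 ≤ ∣ S ∩ line ℓ ∣) →
                     S ─ T ⊆ S′ → S′ ⊆ S → Semioval Π S′
  semioval-between {S} {T} {S′} S-semioval@(_ , tangents) thin S─T⊆S′ S′⊆S = nonempty , tangent
    where
    nonempty : Nonempty S′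
    nonempty with semioval⇒∃secant S-semioval
    ... | ℓ , secant with ∣p∣<∣q∣⇒∃x∈q∧x∉p (T ∩ line ℓ) (S ∩ line ℓ) ∣T∩ℓ∣<∣S∩ℓ∣
      where
      ∣T∩ℓ∣<∣S∩ℓ∣ : ∣ T ∩ line ℓ ∣ < ∣ S ∩ line ℓ ∣
      ∣T∩ℓ∣<∣S∩ℓ∣ = ≤-trans (m<m+n ∣ T ∩ line ℓ ∣ (s≤s z≤n)) (thin ℓ secant)
    ... | x , x∈S∩ℓ , x∉T∩ℓ with x∈p∩q⁻ S _ x∈S∩ℓ
    ... | x∈S , x∈ℓ = x , S─T⊆S′ (x∈p∧x∉q⇒x∈p─q x∈S (λ x∈T → x∉T∩ℓ (x∈p∩q⁺ (x∈T , x∈ℓ))))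

    tangent : ∀ P → P ∈ S′ → ∃ λ t → IsTangent Π S′ P t × (∀ t′ → IsTangent Π S′ P t′ → t′ ≡ t)
    tangent P P∈S′ with tangents P (S′⊆S P∈S′)
    ... | t , S-tangent , S-unique = t , tangent-⊆ S′⊆S P∈S′ S-tangent , unique
      where
      unique : ∀ t′ → IsTangent Π S′ P t′ → t′ ≡ t
      unique t′ S′-tangent with tangent⊎secant (S′⊆S P∈S′) (tangent-point∈line S′-tangent)
      ... | inj₁ S-tangent′ = S-unique t′ S-tangent′
      ... | inj₂ secant     = contradiction (thin t′ secant) (<⇒≱ ∣S∩t′∣<∣T∩t′∣+2)
        where
        ∣S∩t′∣<∣T∩t′∣+2 : ∣ S ∩ line t′ ∣ < ∣ T ∩ line t′ ∣ + 2
        ∣S∩t′∣<∣T∩t′∣+2 = begin-strict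
          ∣ S ∩ line t′ ∣                     ≤⟨ p─r⊆q⇒∣p∩s∣≤∣q∩s∣+∣r∩s∣ (line t′) S─T⊆S′ ⟩
          ∣ S′ ∩ line t′ ∣ + ∣ T ∩ line t′ ∣  ≡⟨ cong (_+ ∣ T ∩ line t′ ∣) ∣S′∩t′∣≡1 ⟩
          suc ∣ T ∩ line t′ ∣                 ≡⟨ +-comm 1 ∣ T ∩ line t′ ∣ ⟩
          ∣ T ∩ line t′ ∣ + 1                 <⟨ +-monoʳ-< ∣ T ∩ line t′ ∣ ≤-refl ⟩
          ∣ T ∩ line t′ ∣ + 2                 ∎
          where
          open ≤-Reasoning
          ∣S′∩t′∣≡1 : ∣ S′ ∩ line t′ ∣ ≡ 1
          ∣S′∩t′∣≡1 = trans (cong ∣_∣ S′-tangent) (∣⁅x⁆∣≡1 P)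

proposition2p1 : ∀ {np nl : ℕ} (Π : ProjectivePlane np nl) (S T : Subset np) →
    Semioval Π S → T ⊆ S →
    (∀ ℓ → 2 ≤ ∣ S ∩ ProjectivePlane.line Π ℓ ∣ →
       ∣ T ∩ ProjectivePlane.line Π ℓ ∣ + 2 ≤ ∣ S ∩ ProjectivePlane.line Π ℓ ∣) →
    Semioval Π (S ─ T) ×
    (∀ k → ∣ S ─ T ∣ ≤ k → k ≤ ∣ S ∣ →
       ∃ λ (S′ : Subset np) → S′ ⊆ S × Semioval Π S′ × ∣ S′ ∣ ≡ k)
proposition2p1 {np} Π S T S-semioval _ thin =
  semioval-between Π S-semioval thin id (p─q⊆p S T) , of-size
  where
  of-size : ∀ k → ∣ S ─ T ∣ ≤ k → k ≤ ∣ S ∣ →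
            ∃ λ (S′ : Subset np) → S′ ⊆ S × Semioval Π S′ × ∣ S′ ∣ ≡ k
  of-size k ∣S─T∣≤k k≤∣S∣ with ∃-between-of-size (p─q⊆p S T) ∣S─T∣≤k k≤∣S∣
  ... | S′ , S─T⊆S′ , S′⊆S , ∣S′∣≡k =
    S′ , S′⊆S , semioval-between Π S-semioval thin S─T⊆S′ S′⊆S , ∣S′∣≡k
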